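{- Let $T$ be a (finite) tree rooted at some vertex $r$. There exists a Roman dominating function $f$ of $T$ of minimum weight $\gamma_R(T)$ such that, for all vertices $v$ of $T$, writing $T_v$ for the subtree of $T$ rooted at $v$ (consisting of $v$ and its descendants) and $V_2=\{u : f(u)=2\}$: (1) $N[v]\cap V(T_v)$ contains at most one vertex $u$ with $f(u)=1$; (2) if $f(v)=2$, then $N[v]\cap V(T_v)$ contains at least two private neighbours of $v$ with respect to $V_2$; (3) if $f(v)=0$, then $N[v]\cap V(T_v)$ contains at most one vertex $u$ such that either $f(u)=1$, or $f(u)=2$ and $u$ has exactly one external private neighbour with respect to $V_2$.
   Context: For a graph $G$ and a vertex $v$, $N[v]$ denotes the closed neighbourhood of $v$ (the set of neighbours of $v$ together with $v$). A Roman dominating function of $G$ is a map $f\colon V(G)\to\{0,1,2\}$ such that every vertex $v$ with $f(v)=0$ has a neighbour $u$ with $f(u)=2$; its weight is $\sum_{v} f(v)$, and $\gamma_R(G)$ is the minimum weight of a Roman dominating function of $G$. For a set $V_2\subseteq V(G)$ and $v\in V_2$, a vertex $u$ is a private neighbour of $v$ with respect to $V_2$ if $u\in N[v]$ but $u\notin N[v']$ for all $v'\in V_2\setminus\{v\}$; such a private neighbour is external if $u\in V(G)\setminus V_2$. -}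

module Defs where

open import Data.Nat using (ℕ; zero; suc; _≤_)
open import Data.Fin using (Fin; toℕ)
open import Data.List using (map; allFin)
open import Data.Nat.ListAction using (sum)
open import Data.Product using (Σ; ∃; ∃-syntax; _×_)
open import Data.Sum using (_⊎_)
open import Relation.Nullary using (¬_)
open import Relation.Binary.PropositionalEquality using (_≡_; _≢_)

iter : ∀ {A : Set} → (A → A) → ℕ → A → A
iter f zero    x = x
iter f (suc k) x = f (iter f k x)

-- A finite rooted tree on the vertex set Fin n, given by its root and
-- parent function.  The root is its own "parent" (a dummy value); every
-- vertex reaches the root by iterating the parent map.  The edges of the
-- tree are exactly {v , parent v} for v ≢ root.  Every finite tree rooted
-- at a vertex r has exactly one such presentation (up to relabelling).
record RootedTree (n : ℕ) : Set where
  field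
    root        : Fin n
    parent      : Fin n → Fin n
    parent-root : parent root ≡ root
    reaches     : ∀ v → ∃[ k ] iter parent k v ≡ root

module _ {n : ℕ} (T : RootedTree n) where
  open RootedTree T

  Adj : Fin n → Fin n → Set
  Adj u v = u ≢ v × (parent u ≡ v ⊎ parent v ≡ u)

  InN : Fin n → Fin n → Set
  InN v u = u ≡ v ⊎ Adj v u

  InSub : Fin n → Fin n → Set
  InSub v u = ∃[ k ] iter parent k u ≡ v

  IsRDF : (Fin n → Fin 3) → Set
  IsRDF f = ∀ v → toℕ (f v) ≡ 0 → ∃[ u ] (Adj v u × toℕ (f u) ≡ 2)

  weight : (Fin n → Fin 3) → ℕ
  weight f = sum (map (λ v → toℕ (f v)) (allFin n))

  IsMinRDF : (Fin n → Fin 3) → Set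
  IsMinRDF f = IsRDF f × (∀ g → IsRDF g → weight f ≤ weight g)

  module _ (f : Fin n → Fin 3) where
    InV2 : Fin n → Set
    InV2 v = toℕ (f v) ≡ 2

    PrivNbr : Fin n → Fin n → Set
    PrivNbr v u = InN v u × (∀ v' → InV2 v' → v' ≢ v → ¬ InN v' u)

    ExtPrivNbr : Fin n → Fin n → Set
    ExtPrivNbr v u = PrivNbr v u × ¬ InV2 u

    InLocal : Fin n → Fin n → Set
    InLocal v u = InN v u × InSub v u

    ExactlyOneExtPriv : Fin n → Set
    ExactlyOneExtPriv v = ∃[ w ] (ExtPrivNbr v w × (∀ w' → ExtPrivNbr v w' → w' ≡ w))

    Cond1 : Fin n → Set
    Cond1 v = ∀ u u' → InLocal v u → toℕ (f u) ≡ 1 → InLocal v u' → toℕ (f u') ≡ 1 → u ≡ u'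

    Cond2 : Fin n → Set
    Cond2 v = InV2 v → ∃[ u ] ∃[ u' ] (u ≢ u' × InLocal v u × PrivNbr v u × InLocal v u' × PrivNbr v u')

    Special : Fin n → Set
    Special u = toℕ (f u) ≡ 1 ⊎ (InV2 u × ExactlyOneExtPriv u)

    Cond3 : Fin n → Set
    Cond3 v = toℕ (f v) ≡ 0 → ∀ u u' → InLocal v u → Special u → InLocal v u' → Special u' → u ≡ u'

{-# OPTIONS --safe #-}
module Submission where

-- Among the Roman dominating functions of minimum weight pick one, f, that also minimises the
-- potential in which a label 1 at depth d costs 2d and a label 2 at depth d costs 4d + 1.
-- Every way of violating one of the three conditions at a vertex v is refuted by relabelling v
-- and a few vertices within distance two of it: the result is again Roman dominating, and it is
-- either lighter than f or equally heavy with smaller potential (such exchanges move labels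
-- towards the root, and the coefficients are chosen so that each of them pays off).

open import Defs
open import Data.Empty using (⊥; ⊥-elim)
open import Data.Fin using (Fin; zero; suc; toℕ)
open import Data.Fin.Patterns using (0F; 1F; 2F)
open import Data.Fin.Properties using (_≟_; any?; all?; punchInᵢ≢i; toℕ-injective)
open import Data.List using (List; []; _∷_; map; allFin; tabulate)
open import Data.List.Properties using (map-tabulate; map-cong)
open import Data.List.Membership.Propositional using (_∈_; _∉_)
open import Data.List.Membership.Propositional.Properties using (∈-map⁺; ∈-map⁻)
import Data.List.Membership.DecPropositional as DecMembership
open import Data.List.Relation.Unary.All as All using (All; []; _∷_)
open import Data.List.Relation.Unary.All.Properties using (All¬⇒¬Any)
open import Data.List.Relation.Unary.Any using (here; there)
open import Data.List.Relation.Unary.Unique.Propositional using (Unique; []; _∷_)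
open import Data.Nat using (ℕ; zero; suc; _+_; _*_; _≤_; _<_; z≤n; s≤s; z<s)
open import Data.Nat.ListAction using (sum)
open import Data.Nat.Properties
  using ( +-0-commutativeMonoid; +-commutativeSemigroup; +-assoc; +-cancelʳ-≡; +-cancelʳ-<; +-monoʳ-<
        ; ≤-refl; ≤-reflexive; ≤-trans; ≤-antisym; <-irrefl; <-trans; <⇒≱; ≮⇒≥; n≤1+n; m<m+n)
  renaming (_≟_ to _≟ℕ_)
open import Data.Nat.Tactic.RingSolver using (solve-∀)
open import Algebra.Properties.CommutativeMonoid.Sum +-0-commutativeMonoid as Σ using (sum-remove; sum-cong-≗)
open import Algebra.Properties.CommutativeSemigroup +-commutativeSemigroup
  using (xy∙z≈zy∙x; xy∙z≈xz∙y; xy∙z≈x∙zy)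
open import Data.Product using (∃; ∃-syntax; _×_; _,_; proj₁; proj₂)
open import Data.Product.Relation.Binary.Lex.Strict using (×-Lex)
open import Data.Sum using (_⊎_; inj₁; inj₂; [_,_]′)
open import Data.Vec.Functional using (updateAt; removeAt) renaming (_∷_ to _◂_)
open import Data.Vec.Functional.Properties using (updateAt-updates; updateAt-minimal)
open import Function using (_∘_; id; const; flip)
open import Relation.Binary.Core using (_Preserves_⟶_)
open import Relation.Binary.Definitions using (_Respects_)
open import Relation.Binary.PropositionalEquality
open import Relation.Nullary using (¬_; Dec; yes; no; contradiction)
open import Relation.Nullary.Decidable using (decidable-stable; _×-dec_; _⊎-dec_; _→-dec_; ¬?; map′)
open import Relation.Unary using (Pred; Decidable)

least : ∀ {p} {P : Pred ℕ p} → Decidable P → ∀ {k} → P k → ∃[ m ] (P m × (∀ {j} → P j → m ≤ j))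
least P? {zero}  P0 = 0 , P0 , λ _ → z≤n
least P? {suc k} Pk with P? 0
... | yes P0 = 0 , P0 , λ _ → z≤n
... | no ¬P0 with least (P? ∘ suc) Pk
...   | m , Pm , m-least = suc m , Pm , λ { {zero} P0 → contradiction P0 ¬P0 ; {suc j} Pj → s≤s (m-least Pj) }

<-by-offset : ∀ {m n} k → m + suc k ≡ n → m < n
<-by-offset {m} k refl = m<m+n m z<s

any?-fun : ∀ {m k q} {Q : Pred (Fin m → Fin k) q} → Q Respects _≗_ → Decidable Q → Dec (∃ Q)
any?-fun {zero}  resp Q? = map′ (λ q → _ , q) (λ (g , q) → resp (λ ()) q) (Q? (λ ()))
any?-fun {suc m} resp Q? =
  map′ (λ (a , h , q) → a ◂ h , q)
       (λ (g , q) → g zero , g ∘ suc , resp (λ { zero → refl ; (suc i) → refl }) q)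
       (any? λ a → any?-fun (λ h≗h′ → resp λ { zero → refl ; (suc i) → h≗h′ i }) (Q? ∘ (a ◂_)))

minimiser : ∀ {m k q} {P : Pred (Fin m → Fin k) q} (κ : (Fin m → Fin k) → ℕ) →
            P Respects _≗_ → κ Preserves _≗_ ⟶ _≡_ → Decidable P →
            ∃ P → ∃[ f ] (P f × (∀ g → P g → κ f ≤ κ g))
minimiser {P = P} κ P-resp κ-resp P? (g , Pg) =
  let _ , (f , Pf , κf≡) , least-value = least value? (g , Pg , refl)
  in f , Pf , λ h Ph → subst (_≤ κ h) (sym κf≡) (least-value (h , Ph , refl))
  where
    value? : Decidable (λ j → ∃[ h ] (P h × κ h ≡ j))
    value? j = any?-fun (λ g≗h (Pg , κg≡j) → P-resp g≗h Pg , trans (sym (κ-resp g≗h)) κg≡j)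
                        (λ h → P? h ×-dec κ h ≟ℕ j)

sum-allFin : ∀ {n} (h : Fin n → ℕ) → sum (map h (allFin n)) ≡ Σ.sum h
sum-allFin h = trans (cong sum (map-tabulate id h)) (sum-tabulate h)
  where
    sum-tabulate : ∀ {n} (h : Fin n → ℕ) → sum (tabulate h) ≡ Σ.sum h
    sum-tabulate {zero}  h = refl
    sum-tabulate {suc n} h = cong (h zero +_) (sum-tabulate (h ∘ suc))

-- (x , a , b) relabels the vertex x from a to b.
Change : Set → ℕ → Set
Change A n = Fin n × A × A

module _ {A : Set} where

  cost : ∀ {n} → (Fin n → A → ℕ) → (Fin n → A) → ℕ
  cost {n} F g = sum (map (λ v → F v (g v)) (allFin n))

  cost-cong : ∀ {n} F {g h : Fin n → A} → g ≗ h → cost F g ≡ cost F h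
  cost-cong {n} F g≗h = cong sum (map-cong (λ v → cong (F v) (g≗h v)) (allFin n))

  cost-updateAt : ∀ {n} F (g : Fin n → A) x b →
                  cost F (updateAt g x (const b)) + F x (g x) ≡ cost F g + F x b
  cost-updateAt {suc n} F g x b = begin
    cost F g′ + F x (g x)
      ≡⟨ cong (_+ F x (g x)) (split g′) ⟩
    F x (g′ x) + Σ.sum (removeAt (F ⊛ g′) x) + F x (g x)
      ≡⟨ cong₂ (λ u r → u + r + F x (g x)) (cong (F x) (updateAt-updates x g)) (sum-cong-≗ unchanged) ⟩
    F x b + rest + F x (g x)
      ≡⟨ xy∙z≈zy∙x (F x b) rest (F x (g x)) ⟩
    F x (g x) + rest + F x b
      ≡⟨ cong (_+ F x b) (split g) ⟨
    cost F g + F x b ∎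
    where
      open ≡-Reasoning
      _⊛_ : (Fin (suc n) → A → ℕ) → (Fin (suc n) → A) → Fin (suc n) → ℕ
      (G ⊛ h) v = G v (h v)
      g′ = updateAt g x (const b)
      rest = Σ.sum (removeAt (F ⊛ g) x)
      split : ∀ h → cost F h ≡ (F ⊛ h) x + Σ.sum (removeAt (F ⊛ h) x)
      split h = trans (sum-allFin (F ⊛ h)) (sum-remove (F ⊛ h))
      unchanged : removeAt (F ⊛ g′) x ≗ removeAt (F ⊛ g) x
      unchanged j = cong (F _) (updateAt-minimal _ x g (punchInᵢ≢i x j))

  patch : ∀ {n} → (Fin n → A) → List (Change A n) → Fin n → A
  patch g []                = g
  patch g ((x , _ , b) ∷ L) = updateAt (patch g L) x (const b)

  vertices : ∀ {n} → List (Change A n) → List (Fin n)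
  vertices = map proj₁

  before after : ∀ {n} → (Fin n → A → ℕ) → List (Change A n) → ℕ
  before F L = sum (map (λ (x , a , _) → F x a) L)
  after  F L = sum (map (λ (x , _ , b) → F x b) L)

  StartsFrom : ∀ {n} → (Fin n → A) → List (Change A n) → Set
  StartsFrom g = All (λ (x , a , _) → g x ≡ a)

  patch-∉ : ∀ {n} {g : Fin n → A} {x} L → x ∉ vertices L → patch g L x ≡ g x
  patch-∉ []                x∉L = refl
  patch-∉ ((y , _ , b) ∷ L) x∉L = trans (updateAt-minimal _ y _ (x∉L ∘ here)) (patch-∉ L (x∉L ∘ there))

  patch-∈ : ∀ {n} {g : Fin n → A} {x a b} L → Unique (vertices L) → (x , a , b) ∈ L → patch g L x ≡ b
  patch-∈ ((y , _ , b) ∷ L) _              (here refl) = updateAt-updates y _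
  patch-∈ ((y , _ , b) ∷ L) (y∉L ∷ unique) (there x∈L) =
    trans (updateAt-minimal _ y _ x≢y) (patch-∈ L unique x∈L)
    where x≢y = λ x≡y → All¬⇒¬Any y∉L (subst (_∈ vertices L) x≡y (∈-map⁺ proj₁ x∈L))

  cost-patch : ∀ {n} F {g : Fin n → A} L → Unique (vertices L) → StartsFrom g L →
               cost F (patch g L) + before F L ≡ cost F g + after F L
  cost-patch F []                _              _               = refl
  cost-patch F {g} ((x , a , b) ∷ L) (x∉L ∷ unique) (gx≡a ∷ from) = begin
    cost F p′ + (F x a + before F L)
      ≡⟨ cong (λ c → cost F p′ + (F x c + before F L)) (trans (patch-∉ L (All¬⇒¬Any x∉L)) gx≡a) ⟨
    cost F p′ + (F x (p x) + before F L)
      ≡⟨ +-assoc (cost F p′) _ _ ⟨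
    cost F p′ + F x (p x) + before F L
      ≡⟨ cong (_+ before F L) (cost-updateAt F p x b) ⟩
    cost F p + F x b + before F L
      ≡⟨ xy∙z≈xz∙y (cost F p) (F x b) (before F L) ⟩
    cost F p + before F L + F x b
      ≡⟨ cong (_+ F x b) (cost-patch F L unique from) ⟩
    cost F g + after F L + F x b
      ≡⟨ xy∙z≈x∙zy (cost F g) (after F L) (F x b) ⟩
    cost F g + (F x b + after F L) ∎
    where
      open ≡-Reasoning
      p = patch g L
      p′ = updateAt p x (const b)

  cost-patch-< : ∀ {n} F {g : Fin n → A} L → Unique (vertices L) → StartsFrom g L →
                 after F L < before F L → cost F (patch g L) < cost F g
  cost-patch-< F {g} L unique from F< = +-cancelʳ-< (before F L) _ _
    (subst (_< cost F g + before F L) (sym (cost-patch F L unique from)) (+-monoʳ-< (cost F g) F<))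

  cost-patch-≡ : ∀ {n} F {g : Fin n → A} L → Unique (vertices L) → StartsFrom g L →
                 after F L ≡ before F L → cost F (patch g L) ≡ cost F g
  cost-patch-≡ F {g} L unique from F≡ = +-cancelʳ-≡ (before F L) _ _
    (trans (cost-patch F L unique from) (cong (cost F g +_) F≡))

  patch-<ₗₑₓ : ∀ {n} F G {g : Fin n → A} L → Unique (vertices L) → StartsFrom g L →
               ×-Lex _≡_ _<_ _<_ (after F L , after G L) (before F L , before G L) →
               ×-Lex _≡_ _<_ _<_ (cost F (patch g L) , cost G (patch g L)) (cost F g , cost G g)
  patch-<ₗₑₓ F G L unique from (inj₁ F<)        = inj₁ (cost-patch-< F L unique from F<)
  patch-<ₗₑₓ F G L unique from (inj₂ (F≡ , G<)) =
    inj₂ (cost-patch-≡ F L unique from F≡ , cost-patch-< G L unique from G<)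

module TreeProperties {n : ℕ} (T : RootedTree n) where
  open RootedTree T

  ChildOf : Fin n → Fin n → Set
  ChildOf v c = c ≢ v × parent c ≡ v

  SelfOrChild : Fin n → Fin n → Set
  SelfOrChild v u = u ≡ v ⊎ ChildOf v u

  iter-suc : ∀ k x → iter parent (suc k) x ≡ iter parent k (parent x)
  iter-suc zero    x = refl
  iter-suc (suc k) x = cong parent (iter-suc k x)

  private
    depth-spec : ∀ u → ∃[ d ] (iter parent d u ≡ root × (∀ {k} → iter parent k u ≡ root → d ≤ k))
    depth-spec u = let k , reach = reaches u in
                   least {P = λ j → iter parent j u ≡ root} (λ j → iter parent j u ≟ root) {k} reach

  depth : Fin n → ℕ
  depth u = proj₁ (depth-spec u)

  depth-reaches : ∀ u → iter parent (depth u) u ≡ root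
  depth-reaches u = proj₁ (proj₂ (depth-spec u))

  depth-least : ∀ u {k} → iter parent k u ≡ root → depth u ≤ k
  depth-least u = proj₂ (proj₂ (depth-spec u))

  depth-parent : ∀ {x} → x ≢ root → depth x ≡ suc (depth (parent x))
  depth-parent {x} x≢root = ≤-antisym (depth-least x via-parent) (at-least (depth x) (depth-reaches x))
    where
      via-parent : iter parent (suc (depth (parent x))) x ≡ root
      via-parent = trans (iter-suc (depth (parent x)) x) (depth-reaches (parent x))
      at-least : ∀ k → iter parent k x ≡ root → suc (depth (parent x)) ≤ k
      at-least zero    x≡root = contradiction x≡root x≢root
      at-least (suc k) reach  = s≤s (depth-least (parent x) (trans (sym (iter-suc k x)) reach))

  depth-child : ∀ {v c} → ChildOf v c → depth c ≡ suc (depth v)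
  depth-child {v} {c} (c≢v , pc≡v) = trans (depth-parent c≢root) (cong (suc ∘ depth) pc≡v)
    where
      c≢root : c ≢ root
      c≢root refl = c≢v (trans (sym parent-root) pc≡v)

  depth-parent-≤ : ∀ x → depth (parent x) ≤ depth x
  depth-parent-≤ x with x ≟ root
  ... | yes refl    = ≤-reflexive (cong depth parent-root)
  ... | no  x≢root = subst (depth (parent x) ≤_) (sym (depth-parent x≢root)) (n≤1+n (depth (parent x)))

  depth-iter : ∀ k u → depth (iter parent k u) ≤ depth u
  depth-iter zero    u = ≤-refl
  depth-iter (suc k) u = ≤-trans (depth-parent-≤ (iter parent k u)) (depth-iter k u)

  child-asym : ∀ {u v} → ChildOf u v → ¬ ChildOf v u
  child-asym v↑u u↑v = <-irrefl refl (<-trans (parent-shallower v↑u) (parent-shallower u↑v))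
    where
      parent-shallower : ∀ {v c} → ChildOf v c → depth v < depth c
      parent-shallower c↑v = ≤-reflexive (sym (depth-child c↑v))

  parent-unique : ∀ {u v c} → ChildOf u c → ChildOf v c → u ≡ v
  parent-unique (_ , pc≡u) (_ , pc≡v) = trans (sym pc≡u) pc≡v

  inLocal⇒selfOrChild : ∀ {f v u} → InLocal T f v u → SelfOrChild v u
  inLocal⇒selfOrChild (inj₁ u≡v , _)               = inj₁ u≡v
  inLocal⇒selfOrChild (inj₂ (v≢u , inj₂ pu≡v) , _) = inj₂ (≢-sym v≢u , pu≡v)
  inLocal⇒selfOrChild {v = v} {u} (inj₂ (v≢u , inj₁ pv≡u) , k , iter≡v) =
    contradiction (subst (λ w → depth w ≤ depth u) iter≡v (depth-iter k u))
                  (<⇒≱ (≤-reflexive (sym (depth-child (v≢u , pv≡u)))))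

  selfOrChild⇒inLocal : ∀ {f v u} → SelfOrChild v u → InLocal T f v u
  selfOrChild⇒inLocal (inj₁ u≡v)          = inj₁ u≡v , 0 , u≡v
  selfOrChild⇒inLocal (inj₂ (u≢v , pu≡v)) = inj₂ (≢-sym u≢v , inj₂ pu≡v) , 1 , pu≡v

  Adj-sym : ∀ {u v} → Adj T u v → Adj T v u
  Adj-sym (u≢v , inj₁ pu≡v) = ≢-sym u≢v , inj₂ pu≡v
  Adj-sym (u≢v , inj₂ pv≡u) = ≢-sym u≢v , inj₁ pv≡u

  childOf⇒Adj : ∀ {v c} → ChildOf v c → Adj T c v
  childOf⇒Adj (c≢v , pc≡v) = c≢v , inj₁ pc≡v

  closedNbr⇒Adj : ∀ {w x} → InN T w x → x ≢ w → Adj T w x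
  closedNbr⇒Adj w∋x x≢w = [ flip contradiction x≢w , id ]′ w∋x

  closedNbr-cases : ∀ {v x} → InN T v x → SelfOrChild v x ⊎ ChildOf x v
  closedNbr-cases (inj₁ x≡v)               = inj₁ (inj₁ x≡v)
  closedNbr-cases (inj₂ (v≢x , inj₁ pv≡x)) = inj₂ (v≢x , pv≡x)
  closedNbr-cases (inj₂ (v≢x , inj₂ px≡v)) = inj₁ (inj₂ (≢-sym v≢x , px≡v))

  neighbour-of-child : ∀ {v c x} → ChildOf v c → Adj T c x → x ≢ v → ChildOf c x
  neighbour-of-child (_ , pc≡v) (_   , inj₁ pc≡x) x≢v = contradiction (trans (sym pc≡x) pc≡v) x≢v
  neighbour-of-child _          (c≢x , inj₂ px≡c) _   = ≢-sym c≢x , px≡c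

  children-share-only-parent : ∀ {v c c′ x} → ChildOf v c → ChildOf v c′ → Adj T c x → Adj T c′ x → x ≢ v →
                               c ≡ c′
  children-share-only-parent c↑v c′↑v c~x c′~x x≢v =
    parent-unique (neighbour-of-child c↑v c~x x≢v) (neighbour-of-child c′↑v c′~x x≢v)

  Adj? : ∀ u v → Dec (Adj T u v)
  Adj? u v = ¬? (u ≟ v) ×-dec (parent u ≟ v ⊎-dec parent v ≟ u)

  InN? : ∀ v u → Dec (InN T v u)
  InN? v u = u ≟ v ⊎-dec Adj? v u

  selfOrChild? : ∀ v u → Dec (SelfOrChild v u)
  selfOrChild? v u = u ≟ v ⊎-dec ¬? (u ≟ v) ×-dec parent u ≟ v

  inLocal? : ∀ f v u → Dec (InLocal T f v u)
  inLocal? f v u = map′ (selfOrChild⇒inLocal {f}) (inLocal⇒selfOrChild {f}) (selfOrChild? v u)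

module RomanDomination {n : ℕ} (T : RootedTree n) where
  open TreeProperties T
  open DecMembership (_≟_ {n}) using (_∈?_)

  Defended : (Fin n → Fin 3) → Fin n → Set
  Defended g x = ∃[ u ] (Adj T x u × toℕ (g u) ≡ 2)

  defended-by : ∀ {g x u} → Adj T x u → g u ≡ 2F → Defended g x
  defended-by x~u gu≡2 = _ , x~u , cong toℕ gu≡2

  isRDF? : ∀ g → Dec (IsRDF T g)
  isRDF? g = all? λ v → toℕ (g v) ≟ℕ 0 →-dec any? λ u → Adj? v u ×-dec toℕ (g u) ≟ℕ 2

  isRDF-resp-≗ : IsRDF T Respects _≗_
  isRDF-resp-≗ g≗h g-isRDF v hv≡0 with g-isRDF v (trans (cong toℕ (g≗h v)) hv≡0)
  ... | u , v~u , gu≡2 = u , v~u , trans (cong toℕ (sym (g≗h u))) gu≡2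

  privNbr? : ∀ f w x → Dec (PrivNbr T f w x)
  privNbr? f w x = InN? w x ×-dec all? λ w′ → toℕ (f w′) ≟ℕ 2 →-dec ¬? (w′ ≟ w) →-dec ¬? (InN? w′ x)

  private-not-2F : ∀ {f w y} → PrivNbr T f w y → y ≢ w → f y ≢ 2F
  private-not-2F (_ , alone) y≢w fy≡2 = alone _ (cong toℕ fy≡2) y≢w (inj₁ refl)

  ¬private⇒shared : ∀ {f w x} → InN T w x → ¬ PrivNbr T f w x →
                    ∃[ w′ ] (toℕ (f w′) ≡ 2 × w′ ≢ w × InN T w′ x)
  ¬private⇒shared {f} {w} {x} w∋x ¬private
    with any? (λ w′ → toℕ (f w′) ≟ℕ 2 ×-dec ¬? (w′ ≟ w) ×-dec InN? w′ x)
  ... | yes shared = shared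
  ... | no ¬shared =
    contradiction (w∋x , λ w′ fw′≡2 w′≢w w′∋x → ¬shared (w′ , fw′≡2 , w′≢w , w′∋x)) ¬private

  OrphansOfDefended : (Fin n → Fin 3) → List (Change (Fin 3) n) → Fin n → Set
  OrphansOfDefended f L w = ∀ {x} → x ∉ vertices L → f x ≡ 0F → Adj T x w → Defended (patch f L) x

  ZeroedDefended OrphansDefended : (Fin n → Fin 3) → List (Change (Fin 3) n) → Set
  ZeroedDefended f L  = All (λ (x , _ , b) → b ≡ 0F → Defended (patch f L) x) L
  OrphansDefended f L = All (λ (w , a , _) → a ≡ 2F → OrphansOfDefended f L w) L

  module Patch {f : Fin n → Fin 3} (f-isRDF : IsRDF T f)
               {L : List (Change (Fin 3) n)} (unique : Unique (vertices L)) (from : StartsFrom f L) where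

    old-label : ∀ {x a b} → (x , a , b) ∈ L → f x ≡ a
    old-label = All.lookup from

    new-label : ∀ {x a b} → (x , a , b) ∈ L → patch f L x ≡ b
    new-label = patch-∈ L unique

    changed : ∀ {x} → x ∈ vertices L → ∃[ a ] ∃[ b ] ((x , a , b) ∈ L)
    changed x∈L with ∈-map⁻ proj₁ x∈L
    ... | (_ , a , b) , xab∈L , refl = a , b , xab∈L

    changed-to : ∀ {x b} → x ∈ vertices L → patch f L x ≡ b → ∃[ a ] ((x , a , b) ∈ L)
    changed-to {x} x∈L gx≡b with changed x∈L
    ... | a , b , xab∈L = a , subst (λ b → (x , a , b) ∈ L) (trans (sym (new-label xab∈L)) gx≡b) xab∈L

    changed-from : ∀ {x a} → x ∈ vertices L → f x ≡ a → ∃[ b ] ((x , a , b) ∈ L)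
    changed-from {x} x∈L fx≡a with changed x∈L
    ... | a , b , xab∈L = b , subst (λ a → (x , a , b) ∈ L) (trans (sym (old-label xab∈L)) fx≡a) xab∈L

    patch-isRDF : ZeroedDefended f L → OrphansDefended f L → IsRDF T (patch f L)
    patch-isRDF zeroed-defended orphans-defended x gx≡0 with x ∈? vertices L
    ... | yes x∈L = All.lookup zeroed-defended (proj₂ (changed-to x∈L (toℕ-injective gx≡0))) refl
    ... | no  x∉L = defended (f-isRDF x (cong toℕ fx≡0))
      where
        fx≡0 : f x ≡ 0F
        fx≡0 = trans (sym (patch-∉ L x∉L)) (toℕ-injective gx≡0)
        defended : Defended f x → Defended (patch f L) x
        defended (w , x~w , fw≡2) with w ∈? vertices L
        ... | yes w∈L =
          All.lookup orphans-defended (proj₂ (changed-from w∈L (toℕ-injective fw≡2))) refl x∉L fx≡0 x~w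
        ... | no  w∉L = w , x~w , trans (cong toℕ (patch-∉ L w∉L)) fw≡2

    non-private-defended : ∀ {w x} → InN T w x → x ≡ w ⊎ f x ≡ 0F → ¬ PrivNbr T f w x →
                           All (λ (w′ , a , _) → a ≡ 2F → InN T w′ x → w′ ≡ w) L →
                           Defended (patch f L) x
    non-private-defended {w} {x} w∋x x≡w⊎fx≡0 ¬private only-w with ¬private⇒shared w∋x ¬private
    ... | w′ , fw′≡2 , w′≢w , w′∋x =
      w′ , Adj-sym (closedNbr⇒Adj w′∋x x≢w′) , trans (cong toℕ (patch-∉ L w′∉L)) fw′≡2
      where
        x≢w′ : x ≢ w′
        x≢w′ refl =
          [ w′≢w , (λ fx≡0 → contradiction (trans (sym fx≡0) (toℕ-injective fw′≡2)) λ ()) ]′ x≡w⊎fx≡0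
        w′∉L : w′ ∉ vertices L
        w′∉L w′∈L =
          w′≢w (All.lookup only-w (proj₂ (changed-from w′∈L (toℕ-injective fw′≡2))) refl w′∋x)

module Extremality {n : ℕ} (T : RootedTree n) where
  open TreeProperties T
  open RomanDomination T

  ω : Fin n → Fin 3 → ℕ
  ω _ = toℕ

  ψ : Fin n → Fin 3 → ℕ
  ψ u 0F = 0
  ψ u 1F = 2 * depth u
  ψ u 2F = suc (4 * depth u)

  _<ₗₑₓ_ : ℕ × ℕ → ℕ × ℕ → Set
  _<ₗₑₓ_ = ×-Lex _≡_ _<_ _<_

  measure : (Fin n → Fin 3) → ℕ × ℕ
  measure g = cost ω g , cost ψ g

  Extremal : (Fin n → Fin 3) → Set
  Extremal f = IsRDF T f × (∀ g → IsRDF T g → ¬ (measure g <ₗₑₓ measure f))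

  extremal⇒isMinRDF : ∀ {f} → Extremal f → IsMinRDF T f
  extremal⇒isMinRDF (f-isRDF , minimal) = f-isRDF , λ g g-isRDF → ≮⇒≥ (minimal g g-isRDF ∘ inj₁)

  extremal-exists : ∃ Extremal
  extremal-exists with minimiser (cost ω) isRDF-resp-≗ (cost-cong ω) isRDF? ((λ _ → 1F) , λ _ ())
  ... | f₀ , f₀-isRDF , f₀-minimal
    with minimiser (cost ψ) (λ g≗h (g-isRDF , ω≡) → isRDF-resp-≗ g≗h g-isRDF , trans (sym (cost-cong ω g≗h)) ω≡)
                   (cost-cong ψ) (λ g → isRDF? g ×-dec cost ω g ≟ℕ cost ω f₀) (f₀ , f₀-isRDF , refl)
  ... | f , (f-isRDF , f≡f₀) , f-minimal = f , f-isRDF , not-below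
    where
      not-below : ∀ g → IsRDF T g → ¬ (measure g <ₗₑₓ measure f)
      not-below g g-isRDF (inj₁ ω<)        = <⇒≱ ω< (subst (_≤ cost ω g) (sym f≡f₀) (f₀-minimal g g-isRDF))
      not-below g g-isRDF (inj₂ (ω≡ , ψ<)) = <⇒≱ ψ< (f-minimal g (g-isRDF , trans ω≡ f≡f₀))

  module Exchange {f : Fin n → Fin 3} (f-extremal : Extremal f) where
    open RootedTree T using (parent)

    f-isRDF : IsRDF T f
    f-isRDF = proj₁ f-extremal

    no-improving-patch : ∀ L → Unique (vertices L) → StartsFrom f L → ZeroedDefended f L → OrphansDefended f L →
                         ¬ ((after ω L , after ψ L) <ₗₑₓ (before ω L , before ψ L))
    no-improving-patch L unique from zeroed orphans improves =
      proj₂ f-extremal (patch f L) (Patch.patch-isRDF f-isRDF unique from zeroed orphans)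
                       (patch-<ₗₑₓ ω ψ L unique from improves)

    no-1F-beside-2F : ∀ {y u} → f y ≡ 1F → Adj T y u → f u ≡ 2F → ⊥
    no-1F-beside-2F {y} {u} fy≡1 y~u@(y≢u , _) fu≡2 =
      no-improving-patch L ([] ∷ []) (fy≡1 ∷ []) (y-defended ∷ []) ((λ ()) ∷ []) (inj₁ (s≤s z≤n))
      where
        L : List (Change (Fin 3) n)
        L = (y , 1F , 0F) ∷ []
        y-defended : 0F ≡ 0F → Defended (patch f L) y
        y-defended _ = defended-by y~u (trans (patch-∉ L λ { (here u≡y) → y≢u (sym u≡y) }) fu≡2)

    private-neighbour-is-0F : ∀ {w y} → f w ≡ 2F → PrivNbr T f w y → y ≢ w → f y ≡ 0F
    private-neighbour-is-0F {w} {y} fw≡2 y-private@(w∋y , _) y≢w with f y in fy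
    ... | 0F = refl
    ... | 1F = ⊥-elim (no-1F-beside-2F fy (Adj-sym (closedNbr⇒Adj w∋y y≢w)) fw≡2)
    ... | 2F = ⊥-elim (private-not-2F y-private y≢w fy)

    ext-private-of-child : ∀ {v c e} → ChildOf v c → f c ≡ 2F → ExtPrivNbr T f c e → e ≢ v →
                           ChildOf c e × f e ≡ 0F
    ext-private-of-child c↑v fc≡2 (e-private@(c∋e , _) , e∉V2) e≢v =
      e↑c , private-neighbour-is-0F fc≡2 e-private (proj₁ e↑c)
      where
        e↑c = [ (λ e≡c → contradiction (trans (cong (toℕ ∘ f) e≡c) (cong toℕ fc≡2)) e∉V2)
              , (λ c~e → neighbour-of-child c↑v c~e e≢v) ]′ c∋e

    unique-ext-private⇒¬private : ∀ {c e x} → (∀ w → ExtPrivNbr T f c w → w ≡ e) → f x ≡ 0F → x ≢ e →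
                                  ¬ PrivNbr T f c x
    unique-ext-private⇒¬private only-e fx≡0 x≢e x-private =
      x≢e (only-e _ (x-private , λ fx≡2 → contradiction (trans (cong toℕ (sym fx≡0)) fx≡2) λ ()))

    no-1F-child-of-1F : ∀ {v c} → ChildOf v c → f v ≡ 1F → f c ≡ 1F → ⊥
    no-1F-child-of-1F {v} {c} c↑v@(c≢v , _) fv≡1 fc≡1 =
      no-improving-patch L unique from zeroed ((λ ()) ∷ (λ ()) ∷ []) (inj₂ (refl , ψ-drop))
      where
        L : List (Change (Fin 3) n)
        L = (v , 1F , 2F) ∷ (c , 1F , 0F) ∷ []
        unique : Unique (vertices L)
        unique = (≢-sym c≢v ∷ []) ∷ [] ∷ []
        from : StartsFrom f L
        from = fv≡1 ∷ fc≡1 ∷ []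
        open Patch f-isRDF unique from
        zeroed : ZeroedDefended f L
        zeroed = (λ ()) ∷ (λ _ → defended-by (childOf⇒Adj c↑v) (new-label (here refl))) ∷ []
        ψ-drop : after ψ L < before ψ L
        ψ-drop rewrite depth-child c↑v = <-by-offset 0 (identity (depth v))
          where
            -- Both sides are written exactly as `after ψ L` and `before ψ L` normalise, trailing `+ 0` included.
            identity : ∀ d → suc (4 * d) + 0 + 1 ≡ 2 * d + (2 * suc d + 0)
            identity = solve-∀

    no-two-1F-children-of-0F : ∀ {v c c′} → f v ≡ 0F → ChildOf v c → ChildOf v c′ → c ≢ c′ →
                               f c ≡ 1F → f c′ ≡ 1F → ⊥
    no-two-1F-children-of-0F {v} {c} {c′} fv≡0 c↑v@(c≢v , _) c′↑v@(c′≢v , _) c≢c′ fc≡1 fc′≡1 =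
      no-improving-patch L unique from zeroed ((λ ()) ∷ (λ ()) ∷ (λ ()) ∷ []) (inj₂ (refl , ψ-drop))
      where
        L : List (Change (Fin 3) n)
        L = (v , 0F , 2F) ∷ (c , 1F , 0F) ∷ (c′ , 1F , 0F) ∷ []
        unique : Unique (vertices L)
        unique = (≢-sym c≢v ∷ ≢-sym c′≢v ∷ []) ∷ (c≢c′ ∷ []) ∷ [] ∷ []
        from : StartsFrom f L
        from = fv≡0 ∷ fc≡1 ∷ fc′≡1 ∷ []
        open Patch f-isRDF unique from
        zeroed : ZeroedDefended f L
        zeroed = (λ ())
               ∷ (λ _ → defended-by (childOf⇒Adj c↑v) (new-label (here refl)))
               ∷ (λ _ → defended-by (childOf⇒Adj c′↑v) (new-label (here refl))) ∷ []
        ψ-drop : after ψ L < before ψ L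
        ψ-drop rewrite depth-child c↑v | depth-child c′↑v = <-by-offset 2 (identity (depth v))
          where
            identity : ∀ d → suc (4 * d) + 0 + 3 ≡ 2 * suc d + (2 * suc d + 0)
            identity = solve-∀

    no-private-but-self : ∀ {v} → f v ≡ 2F → (∀ {z} → PrivNbr T f v z → z ≡ v) → ⊥
    no-private-but-self {v} fv≡2 privates =
      no-improving-patch L ([] ∷ []) (fv≡2 ∷ []) ((λ ()) ∷ []) ((λ _ → orphans) ∷ []) (inj₁ (s≤s (s≤s z≤n)))
      where
        L : List (Change (Fin 3) n)
        L = (v , 2F , 1F) ∷ []
        open Patch f-isRDF ([] ∷ []) (fv≡2 ∷ [])
        orphans : OrphansOfDefended f L v
        orphans _ fx≡0 x~v@(x≢v , _) =
          non-private-defended (inj₂ (Adj-sym x~v)) (inj₂ fx≡0) (x≢v ∘ privates) ((λ _ _ → refl) ∷ [])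

    no-private-but : ∀ {v y} → f v ≡ 2F → y ≢ v → PrivNbr T f v y →
                     (∀ {z} → PrivNbr T f v z → z ≡ y) → ⊥
    no-private-but {v} {y} fv≡2 y≢v y-private privates =
      no-improving-patch L unique from ((λ _ → v-defended) ∷ (λ ()) ∷ []) ((λ _ → orphans) ∷ (λ ()) ∷ [])
                         (inj₁ (s≤s (s≤s z≤n)))
      where
        L : List (Change (Fin 3) n)
        L = (v , 2F , 0F) ∷ (y , 0F , 1F) ∷ []
        unique : Unique (vertices L)
        unique = (≢-sym y≢v ∷ []) ∷ [] ∷ []
        from : StartsFrom f L
        from = fv≡2 ∷ private-neighbour-is-0F fv≡2 y-private y≢v ∷ []
        open Patch f-isRDF unique from
        only-v : ∀ {x} → All (λ (w′ , a , _) → a ≡ 2F → InN T w′ x → w′ ≡ v) L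
        only-v = (λ _ _ → refl) ∷ (λ ()) ∷ []
        v-defended : Defended (patch f L) v
        v-defended = non-private-defended (inj₁ refl) (inj₁ refl) (y≢v ∘ sym ∘ privates) only-v
        orphans : OrphansOfDefended f L v
        orphans x∉L fx≡0 x~v =
          non-private-defended (inj₂ (Adj-sym x~v)) (inj₂ fx≡0) (x∉L ∘ there ∘ here ∘ privates) only-v

    no-unique-private : ∀ {v y} → f v ≡ 2F → PrivNbr T f v y → (∀ {z} → PrivNbr T f v z → z ≡ y) → ⊥
    no-unique-private {v} {y} fv≡2 y-private privates with y ≟ v
    ... | yes refl = no-private-but-self fv≡2 privates
    ... | no  y≢v  = no-private-but fv≡2 y≢v y-private privates

    no-private-but-self-and-parent : ∀ {v p} → f v ≡ 2F → ChildOf p v → PrivNbr T f v p →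
                                     (∀ {z} → PrivNbr T f v z → z ≡ v ⊎ z ≡ p) → ⊥
    no-private-but-self-and-parent {v} {p} fv≡2 v↑p@(v≢p , _) p-private privates =
      no-improving-patch L unique from ((λ _ → v-defended) ∷ (λ ()) ∷ []) ((λ _ → orphans) ∷ (λ ()) ∷ [])
                         (inj₂ (refl , ψ-drop))
      where
        L : List (Change (Fin 3) n)
        L = (v , 2F , 0F) ∷ (p , 0F , 2F) ∷ []
        unique : Unique (vertices L)
        unique = (v≢p ∷ []) ∷ [] ∷ []
        from : StartsFrom f L
        from = fv≡2 ∷ private-neighbour-is-0F fv≡2 p-private (≢-sym v≢p) ∷ []
        open Patch f-isRDF unique from
        v-defended : Defended (patch f L) v
        v-defended = defended-by (childOf⇒Adj v↑p) (new-label (there (here refl)))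
        orphans : OrphansOfDefended f L v
        orphans x∉L fx≡0 x~v =
          non-private-defended (inj₂ (Adj-sym x~v)) (inj₂ fx≡0)
                               ([ x∉L ∘ here , x∉L ∘ there ∘ here ]′ ∘ privates)
                               ((λ _ _ → refl) ∷ (λ ()) ∷ [])
        ψ-drop : after ψ L < before ψ L
        ψ-drop rewrite depth-child v↑p = <-by-offset 3 (identity (depth p))
          where
            identity : ∀ d → suc (4 * d) + 0 + 4 ≡ suc (4 * suc d) + 0
            identity = solve-∀

    no-private-but-child-and-parent : ∀ {v p c} → f v ≡ 2F → ChildOf p v → ChildOf v c →
                                      PrivNbr T f v p → PrivNbr T f v c →
                                      (∀ {z} → PrivNbr T f v z → z ≡ c ⊎ z ≡ p) → ⊥
    no-private-but-child-and-parent {v} {p} {c} fv≡2 v↑p@(v≢p , _) c↑v@(c≢v , _) p-private c-private privates =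
      no-improving-patch L unique from ((λ _ → v-defended) ∷ (λ ()) ∷ (λ ()) ∷ [])
                         ((λ _ → orphans) ∷ (λ ()) ∷ (λ ()) ∷ []) (inj₂ (refl , ψ-drop))
      where
        L : List (Change (Fin 3) n)
        L = (v , 2F , 0F) ∷ (p , 0F , 1F) ∷ (c , 0F , 1F) ∷ []
        unique : Unique (vertices L)
        unique = (v≢p ∷ ≢-sym c≢v ∷ []) ∷ ((λ { refl → child-asym v↑p c↑v }) ∷ []) ∷ [] ∷ []
        from : StartsFrom f L
        from = fv≡2 ∷ private-neighbour-is-0F fv≡2 p-private (≢-sym v≢p)
                    ∷ private-neighbour-is-0F fv≡2 c-private c≢v ∷ []
        open Patch f-isRDF unique from
        only-v : ∀ {x} → All (λ (w′ , a , _) → a ≡ 2F → InN T w′ x → w′ ≡ v) L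
        only-v = (λ _ _ → refl) ∷ (λ ()) ∷ (λ ()) ∷ []
        v-defended : Defended (patch f L) v
        v-defended = non-private-defended (inj₁ refl) (inj₁ refl) ([ c≢v ∘ sym , v≢p ]′ ∘ privates) only-v
        orphans : OrphansOfDefended f L v
        orphans x∉L fx≡0 x~v =
          non-private-defended (inj₂ (Adj-sym x~v)) (inj₂ fx≡0)
                               ([ x∉L ∘ there ∘ there ∘ here , x∉L ∘ there ∘ here ]′ ∘ privates) only-v
        ψ-drop : after ψ L < before ψ L
        ψ-drop rewrite depth-child c↑v | depth-child v↑p = <-by-offset 0 (identity (depth p))
          where
            identity : ∀ d → 2 * d + (2 * suc (suc d) + 0) + 1 ≡ suc (4 * suc d) + 0
            identity = solve-∀

    no-private-but-local-and-parent : ∀ {v p x} → f v ≡ 2F → ChildOf p v → SelfOrChild v x →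
                                      PrivNbr T f v p → PrivNbr T f v x →
                                      (∀ {z} → PrivNbr T f v z → z ≡ x ⊎ z ≡ p) → ⊥
    no-private-but-local-and-parent fv≡2 v↑p (inj₁ refl) p-private _ =
      no-private-but-self-and-parent fv≡2 v↑p p-private
    no-private-but-local-and-parent fv≡2 v↑p (inj₂ x↑v) p-private x-private =
      no-private-but-child-and-parent fv≡2 v↑p x↑v p-private x-private

    no-1F-and-2F-children-of-0F-private-parent :
      ∀ {v c c′} → f v ≡ 0F → ChildOf v c → ChildOf v c′ → c ≢ c′ → f c ≡ 1F → f c′ ≡ 2F →
      (∀ w → ExtPrivNbr T f c′ w → w ≡ v) → ⊥
    no-1F-and-2F-children-of-0F-private-parent {v} {c} {c′}
                                               fv≡0 c↑v@(c≢v , _) c′↑v@(c′≢v , _) c≢c′ fc≡1 fc′≡2 only-v =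
      no-improving-patch L unique from zeroed ((λ ()) ∷ (λ ()) ∷ (λ _ → orphans) ∷ [])
                         (inj₁ (s≤s (s≤s (s≤s z≤n))))
      where
        L : List (Change (Fin 3) n)
        L = (v , 0F , 2F) ∷ (c , 1F , 0F) ∷ (c′ , 2F , 0F) ∷ []
        unique : Unique (vertices L)
        unique = (≢-sym c≢v ∷ ≢-sym c′≢v ∷ []) ∷ (c≢c′ ∷ []) ∷ [] ∷ []
        from : StartsFrom f L
        from = fv≡0 ∷ fc≡1 ∷ fc′≡2 ∷ []
        open Patch f-isRDF unique from
        zeroed : ZeroedDefended f L
        zeroed = (λ ())
               ∷ (λ _ → defended-by (childOf⇒Adj c↑v) (new-label (here refl)))
               ∷ (λ _ → defended-by (childOf⇒Adj c′↑v) (new-label (here refl))) ∷ []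
        orphans : OrphansOfDefended f L c′
        orphans x∉L fx≡0 x~c′ =
          non-private-defended (inj₂ (Adj-sym x~c′)) (inj₂ fx≡0)
                               (unique-ext-private⇒¬private only-v fx≡0 (x∉L ∘ here))
                               ((λ ()) ∷ (λ ()) ∷ (λ _ _ → refl) ∷ [])

    no-1F-and-2F-children-of-0F-private-grandchild :
      ∀ {v c c′ e} → f v ≡ 0F → ChildOf v c → ChildOf v c′ → c ≢ c′ → f c ≡ 1F → f c′ ≡ 2F →
      ExtPrivNbr T f c′ e → (∀ w → ExtPrivNbr T f c′ w → w ≡ e) → e ≢ v → ⊥
    no-1F-and-2F-children-of-0F-private-grandchild {v} {c} {c′} {e}
      fv≡0 c↑v@(c≢v , _) c′↑v@(c′≢v , _) c≢c′ fc≡1 fc′≡2 e-ext only-e e≢v =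
      no-improving-patch L unique from zeroed ((λ ()) ∷ (λ ()) ∷ (λ _ → orphans) ∷ (λ ()) ∷ [])
                         (inj₂ (refl , ψ-drop))
      where
        e↑c′ = ext-private-of-child c′↑v fc′≡2 e-ext e≢v
        L : List (Change (Fin 3) n)
        L = (v , 0F , 2F) ∷ (c , 1F , 0F) ∷ (c′ , 2F , 0F) ∷ (e , 0F , 1F) ∷ []
        unique : Unique (vertices L)
        unique = (≢-sym c≢v ∷ ≢-sym c′≢v ∷ ≢-sym e≢v ∷ [])
               ∷ (c≢c′ ∷ (λ { refl → c′≢v (parent-unique (proj₁ e↑c′) c↑v) }) ∷ [])
               ∷ (≢-sym (proj₁ (proj₁ e↑c′)) ∷ [])
               ∷ [] ∷ []
        from : StartsFrom f L
        from = fv≡0 ∷ fc≡1 ∷ fc′≡2 ∷ proj₂ e↑c′ ∷ []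
        open Patch f-isRDF unique from
        zeroed : ZeroedDefended f L
        zeroed = (λ ())
               ∷ (λ _ → defended-by (childOf⇒Adj c↑v) (new-label (here refl)))
               ∷ (λ _ → defended-by (childOf⇒Adj c′↑v) (new-label (here refl))) ∷ (λ ()) ∷ []
        orphans : OrphansOfDefended f L c′
        orphans x∉L fx≡0 x~c′ =
          non-private-defended (inj₂ (Adj-sym x~c′)) (inj₂ fx≡0)
                               (unique-ext-private⇒¬private only-e fx≡0 (x∉L ∘ there ∘ there ∘ there ∘ here))
                               ((λ ()) ∷ (λ ()) ∷ (λ _ _ → refl) ∷ (λ ()) ∷ [])
        ψ-drop : after ψ L < before ψ L
        ψ-drop rewrite depth-child (proj₁ e↑c′) | depth-child c′↑v | depth-child c↑v =
          <-by-offset 1 (identity (depth v))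
          where
            identity : ∀ d → suc (4 * d) + (2 * suc (suc d) + 0) + 2 ≡ 2 * suc d + (suc (4 * suc d) + 0)
            identity = solve-∀

    no-1F-and-special-2F-children-of-0F :
      ∀ {v c c′} → f v ≡ 0F → ChildOf v c → ChildOf v c′ → c ≢ c′ → f c ≡ 1F → f c′ ≡ 2F →
      ExactlyOneExtPriv T f c′ → ⊥
    no-1F-and-special-2F-children-of-0F {v} fv≡0 c↑v c′↑v c≢c′ fc≡1 fc′≡2 (e , e-ext , only-e) with e ≟ v
    ... | yes refl = no-1F-and-2F-children-of-0F-private-parent fv≡0 c↑v c′↑v c≢c′ fc≡1 fc′≡2 only-e
    ... | no  e≢v  =
      no-1F-and-2F-children-of-0F-private-grandchild fv≡0 c↑v c′↑v c≢c′ fc≡1 fc′≡2 e-ext only-e e≢v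

    no-two-special-2F-children-of-0F :
      ∀ {v c c′} → f v ≡ 0F → ChildOf v c → ChildOf v c′ → c ≢ c′ → f c ≡ 2F → f c′ ≡ 2F →
      ExactlyOneExtPriv T f c → ExactlyOneExtPriv T f c′ → ⊥
    no-two-special-2F-children-of-0F {v} {c} {c′} fv≡0 c↑v@(c≢v , _) c′↑v@(c′≢v , _) c≢c′ fc≡2 fc′≡2
                                     (e , e-ext , only-e) (e′ , e′-ext , only-e′) =
      no-improving-patch L unique from zeroed
                         ((λ ()) ∷ (λ _ → orphans-of-c) ∷ (λ _ → orphans-of-c′) ∷ (λ ()) ∷ (λ ()) ∷ [])
                         (inj₂ (refl , ψ-drop))
      where
        e≢v : e ≢ v
        e≢v refl = proj₂ (proj₁ e-ext) c′ (cong toℕ fc′≡2) (≢-sym c≢c′) (inj₂ (childOf⇒Adj c′↑v))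
        e′≢v : e′ ≢ v
        e′≢v refl = proj₂ (proj₁ e′-ext) c (cong toℕ fc≡2) c≢c′ (inj₂ (childOf⇒Adj c↑v))
        e↑c   = ext-private-of-child c↑v fc≡2 e-ext e≢v
        e′↑c′ = ext-private-of-child c′↑v fc′≡2 e′-ext e′≢v
        L : List (Change (Fin 3) n)
        L = (v , 0F , 2F) ∷ (c , 2F , 0F) ∷ (c′ , 2F , 0F) ∷ (e , 0F , 1F) ∷ (e′ , 0F , 1F) ∷ []
        unique : Unique (vertices L)
        unique = (≢-sym c≢v ∷ ≢-sym c′≢v ∷ ≢-sym e≢v ∷ ≢-sym e′≢v ∷ [])
               ∷ (c≢c′ ∷ ≢-sym (proj₁ (proj₁ e↑c))
                       ∷ (λ { refl → c′≢v (parent-unique (proj₁ e′↑c′) c↑v) }) ∷ [])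
               ∷ ((λ { refl → c≢v (parent-unique (proj₁ e↑c) c′↑v) })
                       ∷ ≢-sym (proj₁ (proj₁ e′↑c′)) ∷ [])
               ∷ ((λ { refl → c≢c′ (parent-unique (proj₁ e↑c) (proj₁ e′↑c′)) }) ∷ [])
               ∷ [] ∷ []
        from : StartsFrom f L
        from = fv≡0 ∷ fc≡2 ∷ fc′≡2 ∷ proj₂ e↑c ∷ proj₂ e′↑c′ ∷ []
        open Patch f-isRDF unique from
        zeroed : ZeroedDefended f L
        zeroed = (λ ())
               ∷ (λ _ → defended-by (childOf⇒Adj c↑v) (new-label (here refl)))
               ∷ (λ _ → defended-by (childOf⇒Adj c′↑v) (new-label (here refl))) ∷ (λ ()) ∷ (λ ()) ∷ []
        siblings-apart : ∀ {a b x} → ChildOf v a → ChildOf v b → Adj T x a → InN T b x →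
                         x ∉ vertices L → (∀ {y} → y ≡ b → y ∈ vertices L) → b ≡ a
        siblings-apart a↑v b↑v x~a b∋x x∉L b∈L =
          sym (children-share-only-parent a↑v b↑v (Adj-sym x~a) (closedNbr⇒Adj b∋x (x∉L ∘ b∈L))
                                          (x∉L ∘ here))
        orphans-of-c : OrphansOfDefended f L c
        orphans-of-c x∉L fx≡0 x~c =
          non-private-defended (inj₂ (Adj-sym x~c)) (inj₂ fx≡0)
            (unique-ext-private⇒¬private only-e fx≡0 (x∉L ∘ there ∘ there ∘ there ∘ here))
            ((λ ()) ∷ (λ _ _ → refl)
                    ∷ (λ _ c′∋x → siblings-apart c↑v c′↑v x~c c′∋x x∉L (there ∘ there ∘ here))
                    ∷ (λ ()) ∷ (λ ()) ∷ [])
        orphans-of-c′ : OrphansOfDefended f L c′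
        orphans-of-c′ x∉L fx≡0 x~c′ =
          non-private-defended (inj₂ (Adj-sym x~c′)) (inj₂ fx≡0)
            (unique-ext-private⇒¬private only-e′ fx≡0 (x∉L ∘ there ∘ there ∘ there ∘ there ∘ here))
            ((λ ()) ∷ (λ _ c∋x → siblings-apart c′↑v c↑v x~c′ c∋x x∉L (there ∘ here))
                    ∷ (λ _ _ → refl) ∷ (λ ()) ∷ (λ ()) ∷ [])
        ψ-drop : after ψ L < before ψ L
        ψ-drop rewrite depth-child (proj₁ e↑c) | depth-child (proj₁ e′↑c′)
                     | depth-child c↑v | depth-child c′↑v =
          <-by-offset 0 (identity (depth v))
          where
            identity : ∀ d → suc (4 * d) + (2 * suc (suc d) + (2 * suc (suc d) + 0)) + 1
                           ≡ suc (4 * suc d) + (suc (4 * suc d) + 0)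
            identity = solve-∀

    no-two-local-1Fs : ∀ {v u u′} → u ≢ u′ → SelfOrChild v u → SelfOrChild v u′ →
                       f u ≡ 1F → f u′ ≡ 1F → ⊥
    no-two-local-1Fs u≢u′ (inj₁ refl) (inj₁ refl) _ _ = u≢u′ refl
    no-two-local-1Fs _ (inj₁ refl) (inj₂ u′↑v) fu≡1 fu′≡1 = no-1F-child-of-1F u′↑v fu≡1 fu′≡1
    no-two-local-1Fs _ (inj₂ u↑v) (inj₁ refl) fu≡1 fu′≡1 = no-1F-child-of-1F u↑v fu′≡1 fu≡1
    no-two-local-1Fs {v} u≢u′ (inj₂ u↑v) (inj₂ u′↑v) fu≡1 fu′≡1 with f v in fv
    ... | 0F = no-two-1F-children-of-0F fv u↑v u′↑v u≢u′ fu≡1 fu′≡1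
    ... | 1F = no-1F-child-of-1F u↑v fv fu≡1
    ... | 2F = no-1F-beside-2F fu≡1 (childOf⇒Adj u↑v) fv

    locate-private : ∀ {v z} → PrivNbr T f v z →
                     SelfOrChild v z ⊎ (v ≢ parent v × PrivNbr T f v (parent v)) × z ≡ parent v
    locate-private z-private with closedNbr-cases (proj₁ z-private)
    ... | inj₁ z-local      = inj₁ z-local
    ... | inj₂ (v≢z , refl) = inj₂ ((v≢z , z-private) , refl)

    no-unique-local-private : ∀ {v} → f v ≡ 2F →
      (∀ {u u′} → SelfOrChild v u → PrivNbr T f v u → SelfOrChild v u′ → PrivNbr T f v u′ → u ≡ u′) → ⊥
    no-unique-local-private {v} fv≡2 local-unique
      with any? (λ x → selfOrChild? v x ×-dec privNbr? f v x) | ¬? (v ≟ parent v) ×-dec privNbr? f v (parent v)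
    ... | no ¬local | no ¬parent =
      no-private-but-self fv≡2 λ z-private →
        ⊥-elim ([ (λ z-local → ¬local (_ , z-local , z-private)) , ¬parent ∘ proj₁ ]′
                  (locate-private z-private))
    ... | no ¬local | yes (v≢p , p-private) =
      no-unique-private fv≡2 p-private λ z-private →
        [ (λ z-local → ⊥-elim (¬local (_ , z-local , z-private))) , proj₂ ]′ (locate-private z-private)
    ... | yes (x , x-local , x-private) | no ¬parent =
      no-unique-private fv≡2 x-private λ z-private →
        [ (λ z-local → local-unique z-local z-private x-local x-private) , ⊥-elim ∘ ¬parent ∘ proj₁ ]′
          (locate-private z-private)
    ... | yes (x , x-local , x-private) | yes (v≢p , p-private) =
      no-private-but-local-and-parent fv≡2 (v≢p , refl) x-local p-private x-private λ z-private →
        [ (λ z-local → inj₁ (local-unique z-local z-private x-local x-private)) , inj₂ ∘ proj₂ ]′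
          (locate-private z-private)

    0F-not-special : ∀ {v} → f v ≡ 0F → ¬ Special T f v
    0F-not-special fv≡0 (inj₁ fv≡1)       = contradiction (trans (cong toℕ (sym fv≡0)) fv≡1) λ ()
    0F-not-special fv≡0 (inj₂ (fv≡2 , _)) = contradiction (trans (cong toℕ (sym fv≡0)) fv≡2) λ ()

    no-two-local-specials : ∀ {v u u′} → f v ≡ 0F → u ≢ u′ → SelfOrChild v u → SelfOrChild v u′ →
                            Special T f u → Special T f u′ → ⊥
    no-two-local-specials fv≡0 _ (inj₁ refl) _ v-special _ = 0F-not-special fv≡0 v-special
    no-two-local-specials fv≡0 _ (inj₂ _) (inj₁ refl) _ v-special = 0F-not-special fv≡0 v-special
    no-two-local-specials fv≡0 u≢u′ (inj₂ u↑v) (inj₂ u′↑v) (inj₁ fu≡1) (inj₁ fu′≡1) =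
      no-two-1F-children-of-0F fv≡0 u↑v u′↑v u≢u′ (toℕ-injective fu≡1) (toℕ-injective fu′≡1)
    no-two-local-specials fv≡0 u≢u′ (inj₂ u↑v) (inj₂ u′↑v) (inj₁ fu≡1) (inj₂ (fu′≡2 , u′-special)) =
      no-1F-and-special-2F-children-of-0F fv≡0 u↑v u′↑v u≢u′
                                          (toℕ-injective fu≡1) (toℕ-injective fu′≡2) u′-special
    no-two-local-specials fv≡0 u≢u′ (inj₂ u↑v) (inj₂ u′↑v) (inj₂ (fu≡2 , u-special)) (inj₁ fu′≡1) =
      no-1F-and-special-2F-children-of-0F fv≡0 u′↑v u↑v (≢-sym u≢u′)
                                          (toℕ-injective fu′≡1) (toℕ-injective fu≡2) u-special
    no-two-local-specials fv≡0 u≢u′ (inj₂ u↑v) (inj₂ u′↑v) (inj₂ (fu≡2 , u-special))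
                          (inj₂ (fu′≡2 , u′-special)) =
      no-two-special-2F-children-of-0F fv≡0 u↑v u′↑v u≢u′
                                       (toℕ-injective fu≡2) (toℕ-injective fu′≡2) u-special u′-special

    cond1 : ∀ v → Cond1 T f v
    cond1 v u u′ u-local fu≡1 u′-local fu′≡1 = decidable-stable (u ≟ u′) λ u≢u′ →
      no-two-local-1Fs u≢u′ (inLocal⇒selfOrChild {f} u-local) (inLocal⇒selfOrChild {f} u′-local)
                       (toℕ-injective fu≡1) (toℕ-injective fu′≡1)

    cond2 : ∀ v → Cond2 T f v
    cond2 v fv≡2 with any? (λ u → any? λ u′ → ¬? (u ≟ u′) ×-dec inLocal? f v u ×-dec privNbr? f v u
                                                           ×-dec inLocal? f v u′ ×-dec privNbr? f v u′)
    ... | yes (u , two) = u , two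
    ... | no ¬two = ⊥-elim (no-unique-local-private (toℕ-injective fv≡2) local-unique)
      where
        local-unique : ∀ {u u′} → SelfOrChild v u → PrivNbr T f v u → SelfOrChild v u′ → PrivNbr T f v u′ →
                       u ≡ u′
        local-unique {u} {u′} u-local u-private u′-local u′-private = decidable-stable (u ≟ u′) λ u≢u′ →
          ¬two (u , u′ , u≢u′ , selfOrChild⇒inLocal {f} u-local , u-private
                              , selfOrChild⇒inLocal {f} u′-local , u′-private)

    cond3 : ∀ v → Cond3 T f v
    cond3 v fv≡0 u u′ u-local u-special u′-local u′-special = decidable-stable (u ≟ u′) λ u≢u′ →
      no-two-local-specials (toℕ-injective fv≡0) u≢u′ (inLocal⇒selfOrChild {f} u-local)
                            (inLocal⇒selfOrChild {f} u′-local) u-special u′-special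

mainTheorem5 : ∀ {n : ℕ} (T : RootedTree n) →
    ∃[ f ] (IsMinRDF T f × (∀ v → Cond1 T f v × Cond2 T f v × Cond3 T f v))
mainTheorem5 T with Extremality.extremal-exists T
... | f , f-extremal = f , extremal⇒isMinRDF f-extremal , λ v → cond1 v , cond2 v , cond3 v
  where
    open Extremality T using (extremal⇒isMinRDF)
    open Extremality.Exchange T f-extremal
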